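{- For every graph $H$, $\widetilde{r}(H) \ge \mathrm{VC}(H)\bigl(\Delta(H)-1\bigr)/2 + |E(H)|$, where $\mathrm{VC}(H)$ is the vertex cover number of $H$ (minimum size of a vertex cover), $\Delta(H)$ is the maximum degree of $H$, and $|E(H)|$ is the number of edges of $H$.
   Context: The online Ramsey game for a target graph $H$ is played between Builder and Painter on an infinite set of vertices, initially with no edges. In each round Builder adds a new edge between two vertices (forming the background graph $G$), and Painter immediately colors that edge red or blue. The online Ramsey number $\widetilde{r}(H)$ is the minimum number $m$ such that Builder has a strategy guaranteeing that, against any Painter strategy, after at most $m$ rounds $G$ contains a monochromatic (not necessarily induced) subgraph isomorphic to $H$. -}

module Defs where

open import Data.Nat using (ℕ; zero; suc; _+_; _*_; _∸_; _⊔_; _≤_; _<ᵇ_)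
open import Data.Bool using (Bool; true; false; if_then_else_; _∧_)
open import Data.Fin using (Fin; toℕ)
open import Data.Fin.Subset using (Subset; _∈_; ∣_∣)
open import Data.List using (List; []; _∷_; map; foldr; allFin)
open import Data.Nat.ListAction using (sum)
import Data.List.Membership.Propositional as LM
open import Data.Product using (Σ; _×_; _,_; ∃)
open import Data.Sum using (_⊎_)
open import Relation.Binary.PropositionalEquality using (_≡_; _≢_)
open import Relation.Nullary using (¬_)
open import Function.Definitions using (Injective)

record Graph : Set where
  field
    n     : ℕ
    adj   : Fin n → Fin n → Bool
    sym   : ∀ i j → adj i j ≡ adj j i
    irref : ∀ i → adj i i ≡ false
open Graph public

deg : (H : Graph) → Fin (n H) → ℕ
deg H i = sum (map (λ j → if adj H i j then 1 else 0) (allFin (n H)))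

maxDeg : Graph → ℕ
maxDeg H = foldr _⊔_ 0 (map (deg H) (allFin (n H)))

numEdges : Graph → ℕ
numEdges H = sum (map (λ i → sum (map (λ j → if adj H i j ∧ (toℕ i <ᵇ toℕ j) then 1 else 0)
                                        (allFin (n H))))
                      (allFin (n H)))

IsVertexCover : (H : Graph) → Subset (n H) → Set
IsVertexCover H S = ∀ i j → adj H i j ≡ true → i ∈ S ⊎ j ∈ S

IsVCNumber : Graph → ℕ → Set
IsVCNumber H k =
  (Σ (Subset (n H)) λ S → IsVertexCover H S × ∣ S ∣ ≡ k)
  × (∀ S → IsVertexCover H S → k ≤ ∣ S ∣)

-- The online Ramsey game.  Vertices of the (infinite) board are ℕ.

data Colour : Set where
  red blue : Colour

Board : Set
Board = List (ℕ × ℕ × Colour)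

Coloured : Board → Colour → ℕ → ℕ → Set
Coloured B c u v = LM._∈_ (u , v , c) B ⊎ LM._∈_ (v , u , c) B

Present : Board → ℕ → ℕ → Set
Present B u v = ∃ λ c → Coloured B c u v

MonoCopy : Graph → Board → Set
MonoCopy H B =
  Σ Colour λ c → Σ (Fin (n H) → ℕ) λ f →
    Injective _≡_ _≡_ f × (∀ i j → adj H i j ≡ true → Coloured B c (f i) (f j))

-- BuilderWins H m B : from position B, Builder has a strategy guaranteeing
-- a monochromatic copy of H within at most m further rounds, against every Painter.
data BuilderWins (H : Graph) : ℕ → Board → Set where
  done : ∀ {m B} → MonoCopy H B → BuilderWins H m B
  move : ∀ {m B} (u v : ℕ) → u ≢ v → ¬ Present B u v →
         (∀ c → BuilderWins H m ((u , v , c) ∷ B)) →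
         BuilderWins H (suc m) B

BuilderWinsWithin : Graph → ℕ → Set
BuilderWinsWithin H m = BuilderWins H m []

-- Painter colours a new edge red unless one of its endpoints already has red degree
-- D = Δ(H) − 1, in which case she colours it blue.  Then no red copy of H can appear
-- unless Δ(H) ≤ 1, and in a blue copy the endpoints of red degree D form a vertex cover
-- of H, so by the handshake lemma there are at least VC(H)·D / 2 red edges; in either
-- case the copy itself contributes |E(H)| edges of its colour.
module Submission where

open import Defs
open import Algebra.Properties.CommutativeSemigroup using (interchange)
open import Data.Bool using (Bool; true; false; T; if_then_else_; _∧_)
open import Data.Bool.Properties using (T-≡; T-∧)
open import Data.Empty using (⊥-elim)
open import Data.Fin using (Fin; toℕ)
open import Data.Fin.Subset using (Subset; ∣_∣) renaming (_∈_ to _∈ₛ_)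
open import Data.List using (List; []; _∷_; _++_; map; length; foldr; allFin; tabulate; cartesianProduct)
open import Data.List.Properties using (length-map; length-++-sucʳ; length-++-≤ʳ; map-++; map-cong; map-∘; map-tabulate)
open import Data.List.Membership.Propositional using (_∈_)
open import Data.List.Membership.Propositional.Properties using (∈-∃++; ∈-++⁺ˡ; ∈-++⁺ʳ; ∈-++⁻; ∈-map⁺)
open import Data.List.Relation.Unary.Any using (here; there)
open import Data.List.Relation.Unary.All as All using ()
open import Data.List.Relation.Unary.AllPairs using (_∷_)
open import Data.List.Relation.Unary.Unique.Propositional using (Unique)
open import Data.List.Relation.Unary.Unique.Propositional.Properties using (allFin⁺; tabulate⁺; cartesianProduct⁺)
open import Data.Nat using (ℕ; zero; suc; _+_; _*_; _∸_; _≤_; _<_; _⊔_; _⊓_; _<ᵇ_; _≡ᵇ_; _≤ᵇ_; z≤n; s≤s; _≟_; _≤?_)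
open import Data.Nat.ListAction using (sum)
open import Data.Nat.ListAction.Properties using (sum-++)
open import Data.Nat.Properties
open import Data.Product using (_×_; _,_; proj₁; proj₂; swap)
open import Data.Product.Properties using (,-injective)
open import Data.Sum as Sum using (_⊎_; inj₁; inj₂)
import Data.Vec as Vec
open import Data.Vec.Properties using (lookup⇒[]=; lookup∘tabulate)
open import Function using (_∘_; Equivalence)
open import Function.Definitions using (Injective)
open import Relation.Binary.Definitions using (DecidableEquality)
open import Relation.Binary.PropositionalEquality
  using (_≡_; _≢_; refl; trans; cong; cong₂; subst; subst₂; module ≡-Reasoning) renaming (sym to ≡-sym)
open import Relation.Nullary using (Dec; yes; no; does)
open import Relation.Nullary.Decidable using (dec-true; T?)

count : {A : Set} → (A → Bool) → List A → ℕ
count p xs = sum (map (λ x → if p x then 1 else 0) xs)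

sum-map-+ : {A : Set} (f g : A → ℕ) (xs : List A) →
            sum (map (λ x → f x + g x) xs) ≡ sum (map f xs) + sum (map g xs)
sum-map-+ f g [] = refl
sum-map-+ f g (x ∷ xs) =
  trans (cong (f x + g x +_) (sum-map-+ f g xs))
        (interchange +-commutativeSemigroup (f x) (g x) (sum (map f xs)) (sum (map g xs)))

sum-cartesianProduct : {A B : Set} (t : A × B → ℕ) (xs : List A) (ys : List B) →
                       sum (map (λ x → sum (map (λ y → t (x , y)) ys)) xs)
                       ≡ sum (map t (cartesianProduct xs ys))
sum-cartesianProduct t [] ys = refl
sum-cartesianProduct t (x ∷ xs) ys = begin
    sum (map (λ y → t (x , y)) ys) + sum (map (λ x′ → sum (map (λ y → t (x′ , y)) ys)) xs)
  ≡⟨ cong₂ _+_ (cong sum (map-∘ ys)) (sum-cartesianProduct t xs ys) ⟩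
    sum (map t (map (x ,_) ys)) + sum (map t (cartesianProduct xs ys))
  ≡⟨ ≡-sym (sum-++ (map t (map (x ,_) ys)) _) ⟩
    sum (map t (map (x ,_) ys) ++ map t (cartesianProduct xs ys))
  ≡⟨ cong sum (≡-sym (map-++ t (map (x ,_) ys) _)) ⟩
    sum (map t (cartesianProduct (x ∷ xs) ys))
  ∎
  where open ≡-Reasoning

module _ {A B : Set} {P : A → Set} (P? : ∀ a → Dec (P a)) (g : A → B)
         (g-injective : ∀ {a b} → P a → P b → g a ≡ g b → a ≡ b) where

  count≤length : ∀ {L M} → Unique L → (∀ {a} → a ∈ L → P a → g a ∈ M) →
                 count (λ a → does (P? a)) L ≤ length M
  count≤length {[]} _ _ = z≤n
  count≤length {a ∷ L} (a∉L ∷ L!) g∈M with P? a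
  ... | no _ = count≤length L! (g∈M ∘ there)
  ... | yes Pa with ∈-∃++ (g∈M (here refl) Pa)
  ...   | ys , zs , refl =
    ≤-trans (s≤s (count≤length L! g∈ys++zs)) (≤-reflexive (≡-sym (length-++-sucʳ ys (g a) zs)))
    where
      g∈ys++zs : ∀ {b} → b ∈ L → P b → g b ∈ ys ++ zs
      g∈ys++zs {b} b∈L Pb with ∈-++⁻ ys (g∈M (there b∈L) Pb)
      ... | inj₁ ∈ys = ∈-++⁺ˡ ∈ys
      ... | inj₂ (here gb≡ga) = ⊥-elim (All.lookup a∉L b∈L (≡-sym (g-injective Pb Pa gb≡ga)))
      ... | inj₂ (there ∈zs) = ∈-++⁺ʳ ys ∈zs

≡ᵇ-true⇒≡ : ∀ m n → (m ≡ᵇ n) ≡ true → m ≡ n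
≡ᵇ-true⇒≡ m n m≡ᵇn = ≡ᵇ⇒≡ m n (Equivalence.from T-≡ m≡ᵇn)

-- does (m ≟ n) computes to m ≡ᵇ n, so lemmas about _≟_ apply to the ≡ᵇ tests below.
count-≡ᵇ≤1 : ∀ u {xs} → Unique xs → count (λ x → x ≡ᵇ u) xs ≤ 1
count-≡ᵇ≤1 u xs! = count≤length (_≟ u) (λ x → x) (λ { refl refl _ → refl }) {M = u ∷ []} xs! (λ { _ refl → here refl })

EdgeList : Set
EdgeList = List (ℕ × ℕ)

Joined : EdgeList → ℕ → ℕ → Set
Joined E u v = (u , v) ∈ E ⊎ (v , u) ∈ E

neighboursVia : ℕ → ℕ × ℕ → List ℕ
neighboursVia x (u , v) = (if x ≡ᵇ u then v ∷ [] else []) ++ (if x ≡ᵇ v then u ∷ [] else [])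

neighbours : EdgeList → ℕ → List ℕ
neighbours [] x = []
neighbours (e ∷ E) x = neighboursVia x e ++ neighbours E x

degree : EdgeList → ℕ → ℕ
degree E x = length (neighbours E x)

degree-∷ : ∀ u v E x → degree ((u , v) ∷ E) x
           ≡ (if x ≡ᵇ u then 1 else 0) + (if x ≡ᵇ v then 1 else 0) + degree E x
degree-∷ u v E x with x ≡ᵇ u | x ≡ᵇ v
... | true | true = refl
... | true | false = refl
... | false | true = refl
... | false | false = refl

degree-≤-∷ : ∀ e E x → degree E x ≤ degree (e ∷ E) x
degree-≤-∷ e E x = length-++-≤ʳ (neighbours E x) {neighboursVia x e}

joined⇒∈neighbours : ∀ {E u v} → Joined E u v → v ∈ neighbours E u
joined⇒∈neighbours {e ∷ E} {u} (inj₁ (here refl)) rewrite dec-true (u ≟ u) refl = here refl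
joined⇒∈neighbours {e ∷ E} {u} {v} (inj₂ (here refl)) rewrite dec-true (u ≟ u) refl =
  ∈-++⁺ˡ (∈-++⁺ʳ (if u ≡ᵇ v then u ∷ [] else []) (here refl))
joined⇒∈neighbours {e ∷ E} {u} (inj₁ (there m)) = ∈-++⁺ʳ (neighboursVia u e) (joined⇒∈neighbours (inj₁ m))
joined⇒∈neighbours {e ∷ E} {u} (inj₂ (there m)) = ∈-++⁺ʳ (neighboursVia u e) (joined⇒∈neighbours (inj₂ m))

handshake : ∀ E {xs} → Unique xs → sum (map (degree E) xs) ≤ 2 * length E
handshake [] {[]} _ = z≤n
handshake [] {_ ∷ _} (_ ∷ xs!) = handshake [] xs!
handshake ((u , v) ∷ E) {xs} xs! = begin
    sum (map (degree ((u , v) ∷ E)) xs)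
  ≡⟨ cong sum (map-cong (degree-∷ u v E) xs) ⟩
    sum (map (λ x → [x≡u] x + [x≡v] x + degree E x) xs)
  ≡⟨ sum-map-+ _ (degree E) xs ⟩
    sum (map (λ x → [x≡u] x + [x≡v] x) xs) + sum (map (degree E) xs)
  ≡⟨ cong (_+ sum (map (degree E) xs)) (sum-map-+ [x≡u] [x≡v] xs) ⟩
    count (λ x → x ≡ᵇ u) xs + count (λ x → x ≡ᵇ v) xs + sum (map (degree E) xs)
  ≤⟨ +-mono-≤ (+-mono-≤ (count-≡ᵇ≤1 u xs!) (count-≡ᵇ≤1 v xs!)) (handshake E xs!) ⟩
    2 + 2 * length E
  ≡⟨ ≡-sym (*-suc 2 (length E)) ⟩
    2 * length ((u , v) ∷ E)
  ∎
  where
    open ≤-Reasoning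
    [x≡u] [x≡v] : ℕ → ℕ
    [x≡u] x = if x ≡ᵇ u then 1 else 0
    [x≡v] x = if x ≡ᵇ v then 1 else 0

degree-cap-∷ : ∀ {E u v D} → u ≢ v → degree E u < D → degree E v < D →
               (∀ x → degree E x ≤ D) → ∀ x → degree ((u , v) ∷ E) x ≤ D
degree-cap-∷ {E} {u} {v} {D} u≢v u< v< cap x rewrite degree-∷ u v E x with x ≡ᵇ u in x≡u | x ≡ᵇ v in x≡v
... | true | true = ⊥-elim (u≢v (trans (≡-sym (≡ᵇ-true⇒≡ x u x≡u)) (≡ᵇ-true⇒≡ x v x≡v)))
... | true | false = subst (λ y → degree E y < D) (≡-sym (≡ᵇ-true⇒≡ x u x≡u)) u<
... | false | true = subst (λ y → degree E y < D) (≡-sym (≡ᵇ-true⇒≡ x v x≡v)) v<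
... | false | false = cap x

atLeast : ∀ {n} → ℕ → (Fin n → ℕ) → Subset n
atLeast D h = Vec.tabulate (λ i → D ≤ᵇ h i)

∈-atLeast : ∀ {n D} {h : Fin n → ℕ} {i} → D ≤ h i → i ∈ₛ atLeast D h
∈-atLeast {D = D} {h} {i} D≤hi =
  lookup⇒[]= i (atLeast D h) (trans (lookup∘tabulate _ i) (Equivalence.to T-≡ (≤⇒≤ᵇ D≤hi)))

∣atLeast∣*≤sum : ∀ {n} D (h : Fin n → ℕ) → ∣ atLeast D h ∣ * D ≤ sum (tabulate h)
∣atLeast∣*≤sum {zero} D h = z≤n
∣atLeast∣*≤sum {suc n} D h with D ≤ᵇ h Fin.zero in D≤h₀
... | true = +-mono-≤ (≤ᵇ⇒≤ D _ (Equivalence.from T-≡ D≤h₀)) (∣atLeast∣*≤sum D (h ∘ Fin.suc))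
... | false = ≤-trans (∣atLeast∣*≤sum D (h ∘ Fin.suc)) (m≤n+m _ (h Fin.zero))

foldr-⊔-map-≤ : {A : Set} (h : A → ℕ) {D : ℕ} → (∀ a → h a ≤ D) → ∀ xs → foldr _⊔_ 0 (map h xs) ≤ D
foldr-⊔-map-≤ h h≤D [] = z≤n
foldr-⊔-map-≤ h h≤D (x ∷ xs) = ⊔-lub (h≤D x) (foldr-⊔-map-≤ h h≤D xs)

unordered : ℕ × ℕ → ℕ × ℕ
unordered (u , v) = (u ⊓ v , u ⊔ v)

unordered-swap : ∀ u v → unordered (u , v) ≡ unordered (v , u)
unordered-swap u v = cong₂ _,_ (⊓-comm u v) (⊔-comm u v)

unordered-≤ : ∀ {u v} → u ≤ v → unordered (u , v) ≡ (u , v)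
unordered-≤ u≤v = cong₂ _,_ (m≤n⇒m⊓n≡m u≤v) (m≤n⇒m⊔n≡n u≤v)

unordered-≥ : ∀ {u v} → v ≤ u → unordered (u , v) ≡ (v , u)
unordered-≥ {u} {v} v≤u = trans (unordered-swap u v) (unordered-≤ v≤u)

unordered-injective : ∀ {u v u′ v′} → unordered (u , v) ≡ unordered (u′ , v′) →
                      (u ≡ u′ × v ≡ v′) ⊎ (u ≡ v′ × v ≡ u′)
unordered-injective {u} {v} {u′} {v′} eq with ≤-total u v | ≤-total u′ v′
... | inj₁ u≤v | inj₁ u′≤v′ = inj₁ (,-injective (trans (≡-sym (unordered-≤ u≤v)) (trans eq (unordered-≤ u′≤v′))))
... | inj₁ u≤v | inj₂ v′≤u′ = inj₂ (,-injective (trans (≡-sym (unordered-≤ u≤v)) (trans eq (unordered-≥ v′≤u′))))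
... | inj₂ v≤u | inj₁ u′≤v′ = inj₂ (swap (,-injective (trans (≡-sym (unordered-≥ v≤u)) (trans eq (unordered-≤ u′≤v′)))))
... | inj₂ v≤u | inj₂ v′≤u′ = inj₁ (swap (,-injective (trans (≡-sym (unordered-≥ v≤u)) (trans eq (unordered-≥ v′≤u′)))))

record Copy (H : Graph) (E : EdgeList) : Set where
  field
    embed           : Fin (n H) → ℕ
    embed-injective : Injective _≡_ _≡_ embed
    embed-adj       : ∀ i j → adj H i j ≡ true → Joined E (embed i) (embed j)

module _ {H : Graph} {E : EdgeList} (C : Copy H E) where
  open Copy C

  deg≤degree : ∀ i → deg H i ≤ degree E (embed i)
  deg≤degree i =
    count≤length (T? ∘ adj H i) embed (λ _ _ → embed-injective) (allFin⁺ (n H))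
      (λ {j} _ ij → joined⇒∈neighbours (embed-adj i j (Equivalence.to T-≡ ij)))

  maxDeg≤ : ∀ {D} → (∀ x → degree E x ≤ D) → maxDeg H ≤ D
  maxDeg≤ degree≤D = foldr-⊔-map-≤ (deg H) (λ i → ≤-trans (deg≤degree i) (degree≤D (embed i))) (allFin (n H))

  numEdges≤length : numEdges H ≤ length E
  numEdges≤length = begin
      numEdges H
    ≡⟨ sum-cartesianProduct (λ a → if forward a then 1 else 0) (allFin (n H)) (allFin (n H)) ⟩
      count forward (cartesianProduct (allFin (n H)) (allFin (n H)))
    ≤⟨ count≤length (T? ∘ forward) image image-injective
         (cartesianProduct⁺ (allFin⁺ (n H)) (allFin⁺ (n H))) image∈ ⟩
      length (map unordered E)
    ≡⟨ length-map unordered E ⟩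
      length E
    ∎
    where
      open ≤-Reasoning
      forward : Fin (n H) × Fin (n H) → Bool
      forward (i , j) = adj H i j ∧ (toℕ i <ᵇ toℕ j)

      image : Fin (n H) × Fin (n H) → ℕ × ℕ
      image (i , j) = unordered (embed i , embed j)

      forward-< : ∀ {i j} → T (forward (i , j)) → toℕ i < toℕ j
      forward-< {i} {j} ij = <ᵇ⇒< (toℕ i) (toℕ j) (proj₂ (Equivalence.to T-∧ ij))

      image-injective : ∀ {a b} → T (forward a) → T (forward b) → image a ≡ image b → a ≡ b
      image-injective {i , j} {i′ , j′} ij i′j′ eq with unordered-injective eq
      ... | inj₁ (i≡i′ , j≡j′) = cong₂ _,_ (embed-injective i≡i′) (embed-injective j≡j′)
      ... | inj₂ (i≡j′ , j≡i′) = ⊥-elim (<-asym (forward-< ij)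
            (subst₂ (λ a b → toℕ a < toℕ b) (≡-sym (embed-injective j≡i′)) (≡-sym (embed-injective i≡j′)) (forward-< i′j′)))

      image∈ : ∀ {a} → a ∈ cartesianProduct (allFin (n H)) (allFin (n H)) → T (forward a) → image a ∈ map unordered E
      image∈ {i , j} _ ij with embed-adj i j (Equivalence.to T-≡ (proj₁ (Equivalence.to T-∧ ij)))
      ... | inj₁ ij∈E = ∈-map⁺ unordered ij∈E
      ... | inj₂ ji∈E = subst (_∈ map unordered E) (unordered-swap (embed j) (embed i)) (∈-map⁺ unordered ji∈E)

vcNumber*D≤2*length : ∀ {H k D} E {f : Fin (n H) → ℕ} → Injective _≡_ _≡_ f → IsVCNumber H k →
                      (∀ i j → adj H i j ≡ true → D ≤ degree E (f i) ⊎ D ≤ degree E (f j)) →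
                      k * D ≤ 2 * length E
vcNumber*D≤2*length {H} {k} {D} E {f} f-injective (_ , minimal) saturated = begin
    k * D
  ≤⟨ *-monoˡ-≤ D (minimal S S-covers) ⟩
    ∣ S ∣ * D
  ≤⟨ ∣atLeast∣*≤sum D (degree E ∘ f) ⟩
    sum (tabulate (degree E ∘ f))
  ≡⟨ cong sum (≡-sym (map-tabulate f (degree E))) ⟩
    sum (map (degree E) (tabulate f))
  ≤⟨ handshake E (tabulate⁺ f-injective) ⟩
    2 * length E
  ∎
  where
    open ≤-Reasoning
    S : Subset (n H)
    S = atLeast D (degree E ∘ f)
    S-covers : IsVertexCover H S
    S-covers i j ij = Sum.map ∈-atLeast ∈-atLeast (saturated i j ij)

_≟ᶜ_ : DecidableEquality Colour
red ≟ᶜ red = yes refl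
red ≟ᶜ blue = no λ ()
blue ≟ᶜ red = no λ ()
blue ≟ᶜ blue = yes refl

colourClass : Colour → Board → EdgeList
colourClass c [] = []
colourClass c ((u , v , c′) ∷ B) = if does (c ≟ᶜ c′) then (u , v) ∷ colourClass c B else colourClass c B

∈-colourClass : ∀ {u v c} B → (u , v , c) ∈ B → (u , v) ∈ colourClass c B
∈-colourClass {c = c} (_ ∷ B) (here refl) rewrite dec-true (c ≟ᶜ c) refl = here refl
∈-colourClass {c = c} ((_ , _ , c′) ∷ B) (there m) with c ≟ᶜ c′
... | yes _ = there (∈-colourClass B m)
... | no _ = ∈-colourClass B m

length-colourClasses : ∀ B → length (colourClass red B) + length (colourClass blue B) ≡ length B
length-colourClasses [] = refl
length-colourClasses ((_ , _ , red) ∷ B) = cong suc (length-colourClasses B)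
length-colourClasses ((_ , _ , blue) ∷ B) =
  trans (+-suc (length (colourClass red B)) _) (cong suc (length-colourClasses B))

monoCopy⇒copy : ∀ {H B} (M : MonoCopy H B) → Copy H (colourClass (proj₁ M) B)
monoCopy⇒copy {B = B} (c , f , f-injective , coloured) = record
  { embed = f
  ; embed-injective = f-injective
  ; embed-adj = λ i j ij → Sum.map (∈-colourClass B) (∈-colourClass B) (coloured i j ij)
  }

module _ (H : Graph) (paint : Board → ℕ → ℕ → Colour) (Safe : Board → Set)
         (safe-∷ : ∀ {B u v} → u ≢ v → Safe B → Safe ((u , v , paint B u v) ∷ B)) where

  builderWins⇒cost≤rounds : ∀ {s X m B} → (∀ {B′} → Safe B′ → MonoCopy H B′ → X ≤ s * length B′) →
                            Safe B → BuilderWins H m B → X ≤ s * (m + length B)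
  builderWins⇒cost≤rounds {s} {m = m} {B} cost safe (done copy) =
    ≤-trans (cost safe copy) (*-monoʳ-≤ s (m≤n+m (length B) m))
  builderWins⇒cost≤rounds {s} {X} {suc m} {B} cost safe (move u v u≢v _ next) =
    ≤-trans (builderWins⇒cost≤rounds {s} {X} cost (safe-∷ u≢v safe) (next (paint B u v)))
            (≤-reflexive (cong (s *_) (+-suc m (length B))))

module CappedPainter (D : ℕ) where

  redDegree : Board → ℕ → ℕ
  redDegree B = degree (colourClass red B)

  paint : Board → ℕ → ℕ → Colour
  paint B u v with D ≤? redDegree B u | D ≤? redDegree B v
  ... | no _ | no _ = red
  ... | yes _ | _ = blue
  ... | no _ | yes _ = blue

  data PaintView (B : Board) (u v : ℕ) : Colour → Set where
    saturated   : D ≤ redDegree B u ⊎ D ≤ redDegree B v → PaintView B u v blue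
    unsaturated : redDegree B u < D → redDegree B v < D → PaintView B u v red

  paint-view : ∀ B u v → PaintView B u v (paint B u v)
  paint-view B u v with D ≤? redDegree B u | D ≤? redDegree B v
  ... | no D≰u | no D≰v = unsaturated (≰⇒> D≰u) (≰⇒> D≰v)
  ... | yes D≤u | _ = saturated (inj₁ D≤u)
  ... | no _ | yes D≤v = saturated (inj₂ D≤v)

  record Invariant (B : Board) : Set where
    field
      red-capped     : ∀ x → redDegree B x ≤ D
      blue-saturated : ∀ {u v} → (u , v) ∈ colourClass blue B → D ≤ redDegree B u ⊎ D ≤ redDegree B v

  invariant-[] : Invariant []
  invariant-[] = record { red-capped = λ _ → z≤n ; blue-saturated = λ () }

  invariant-∷ : ∀ {B u v} → u ≢ v → Invariant B → Invariant ((u , v , paint B u v) ∷ B)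
  invariant-∷ {B} {u} {v} u≢v I = from-view (paint-view B u v)
    where
      open Invariant I
      from-view : ∀ {c} → PaintView B u v c → Invariant ((u , v , c) ∷ B)
      from-view (saturated uv) = record
        { red-capped = red-capped
        ; blue-saturated = λ { (here refl) → uv ; (there m) → blue-saturated m }
        }
      from-view (unsaturated u< v<) = record
        { red-capped = degree-cap-∷ {colourClass red B} u≢v u< v< red-capped
        ; blue-saturated = Sum.map (grows _) (grows _) ∘ blue-saturated
        }
        where
          grows : ∀ x → D ≤ redDegree B x → D ≤ redDegree ((u , v , red) ∷ B) x
          grows x D≤x = ≤-trans D≤x (degree-≤-∷ (u , v) (colourClass red B) x)

n≤n∸1⇒n≡0 : ∀ {n} → n ≤ n ∸ 1 → n ≡ 0
n≤n∸1⇒n≡0 {zero} _ = refl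
n≤n∸1⇒n≡0 {suc n} 1+n≤n = ⊥-elim (1+n≰n 1+n≤n)

module _ (H : Graph) where
  open CappedPainter (maxDeg H ∸ 1)

  copy-cost : ∀ {k} → IsVCNumber H k → ∀ {B} → Invariant B → MonoCopy H B →
              k * (maxDeg H ∸ 1) + 2 * numEdges H ≤ 2 * length B
  copy-cost {k} vc {B} I M@(red , _) = begin
      k * (maxDeg H ∸ 1) + 2 * numEdges H
    ≡⟨ cong (λ Δ → k * (Δ ∸ 1) + 2 * numEdges H) Δ≡0 ⟩
      k * 0 + 2 * numEdges H
    ≡⟨ cong (_+ 2 * numEdges H) (*-zeroʳ k) ⟩
      2 * numEdges H
    ≤⟨ *-monoʳ-≤ 2 (numEdges≤length C) ⟩
      2 * length (colourClass red B)
    ≤⟨ *-monoʳ-≤ 2 (m≤m+n (length (colourClass red B)) (length (colourClass blue B))) ⟩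
      2 * (length (colourClass red B) + length (colourClass blue B))
    ≡⟨ cong (2 *_) (length-colourClasses B) ⟩
      2 * length B
    ∎
    where
      open ≤-Reasoning
      C : Copy H (colourClass red B)
      C = monoCopy⇒copy {H} {B} M
      Δ≡0 : maxDeg H ≡ 0
      Δ≡0 = n≤n∸1⇒n≡0 (maxDeg≤ C (Invariant.red-capped I))
  copy-cost {k} vc {B} I M@(blue , _) = begin
      k * (maxDeg H ∸ 1) + 2 * numEdges H
    ≤⟨ +-mono-≤ (vcNumber*D≤2*length {H} {k} (colourClass red B) {embed} embed-injective vc covered)
                (*-monoʳ-≤ 2 (numEdges≤length C)) ⟩
      2 * length (colourClass red B) + 2 * length (colourClass blue B)
    ≡⟨ ≡-sym (*-distribˡ-+ 2 (length (colourClass red B)) (length (colourClass blue B))) ⟩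
      2 * (length (colourClass red B) + length (colourClass blue B))
    ≡⟨ cong (2 *_) (length-colourClasses B) ⟩
      2 * length B
    ∎
    where
      open ≤-Reasoning
      C : Copy H (colourClass blue B)
      C = monoCopy⇒copy {H} {B} M
      open Copy C
      open Invariant I
      covered : ∀ i j → adj H i j ≡ true →
                  maxDeg H ∸ 1 ≤ redDegree B (embed i) ⊎ maxDeg H ∸ 1 ≤ redDegree B (embed j)
      covered i j ij = Sum.[ blue-saturated , Sum.swap ∘ blue-saturated ] (embed-adj i j ij)

lemma1 : (H : Graph) (k m : ℕ) → IsVCNumber H k → BuilderWinsWithin H m →
         k * (maxDeg H ∸ 1) + 2 * numEdges H ≤ 2 * m
lemma1 H k m vc wins = begin
    k * (maxDeg H ∸ 1) + 2 * numEdges H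
  ≤⟨ builderWins⇒cost≤rounds H paint Invariant invariant-∷ {s = 2} (copy-cost H {k} vc) invariant-[] wins ⟩
    2 * (m + 0)
  ≡⟨ cong (2 *_) (+-identityʳ m) ⟩
    2 * m
  ∎
  where
    open CappedPainter (maxDeg H ∸ 1)
    open ≤-Reasoning
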